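{- Let $t$ be a binary tree with $n$ nodes and consider the partition of its nodes into micro trees produced by the Farzan–Munro algorithm with parameter $B$. For every micro tree $\mu$, the set of positions in $\mathrm{BP}_\mathrm{b}(t)$ occupied by the parentheses corresponding to nodes of $\mu$ is the union of one or two intervals of consecutive positions.
   Context: A binary tree is a rooted tree where each node has a left and a right child slot, each possibly empty. $\mathrm{BP}_\mathrm{b}(t)=\epsilon$ if $t$ is empty and otherwise $\texttt{(}\cdot \mathrm{BP}_\mathrm{b}(t_l)\cdot \texttt{)}\cdot \mathrm{BP}_\mathrm{b}(t_r)$, with $t_l,t_r$ the left and right subtrees of the root; node $v$ corresponds to the matching pair inserted when expanding the subtree rooted at $v$. Applied to a binary tree, the Farzan–Munro tree-covering algorithm with parameter $B$ partitions the nodes into disjoint micro trees, each a connected set of nodes rooted at its topmost node; it is known that there are $\mathrm{O}(n/B)$ micro trees, each has fewer than $2B$ nodes, contracting each micro tree to a single node yields a binary tree (the top-tier tree), and any micro tree having two child micro trees consists of a single node. A child micro tree of $\mu$ is a micro tree whose root's parent lies in $\mu$. -}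

module Defs where

open import Data.Nat using (ℕ; zero; suc; _+_; _*_; _≤_; _<_)
open import Data.List using (List; []; _∷_; _++_; map; length; filter)
open import Data.Product using (_×_; _,_; proj₁; proj₂; map₂)
open import Relation.Binary.PropositionalEquality using (_≡_)
open import Data.Nat.Properties using (_≟_)
open import Data.Sum using (_⊎_)
open import Relation.Nullary using (¬_)

data Tree : Set where
  leaf : Tree                    -- the empty tree
  node : Tree → Tree → Tree

size : Tree → ℕ
size leaf = 0
size (node l r) = suc (size l + size r)

data Node : Tree → Set where
  here : ∀ {l r} → Node (node l r)
  inL  : ∀ {l r} → Node l → Node (node l r)
  inR  : ∀ {l r} → Node r → Node (node l r)

allNodes : (t : Tree) → List (Node t)
allNodes leaf = []
allNodes (node l r) = here ∷ (map inL (allNodes l) ++ map inR (allNodes r))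

data IsChild : {t : Tree} → Node t → Node t → Set where
  childL : ∀ {a b r} → IsChild {node (node a b) r} here (inL here)
  childR : ∀ {l a b} → IsChild {node l (node a b)} here (inR here)
  deepL  : ∀ {l r} {u v : Node l} → IsChild u v → IsChild {node l r} (inL u) (inL v)
  deepR  : ∀ {l r} {u v : Node r} → IsChild u v → IsChild {node l r} (inR u) (inR v)

data Paren : Set where
  open′ close′ : Paren

-- Balanced-parenthesis representation BP_b, each parenthesis labelled with the
-- node it corresponds to:  BP_b(t) = ( · BP_b(t_l) · ) · BP_b(t_r)
BPl : (t : Tree) → List (Paren × Node t)
BPl leaf = []
BPl (node l r) =
  (open′ , here) ∷ (map (map₂ inL) (BPl l) ++ ((close′ , here) ∷ map (map₂ inR) (BPl r)))

BP : Tree → List Paren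
BP t = map proj₁ (BPl t)

-- A partition of the nodes into micro trees is given by a labelling
-- mt : Node t → ℕ ; micro tree k = { v | mt v ≡ k }.

partSize : (t : Tree) → (Node t → ℕ) → ℕ → ℕ
partSize t mt k = length (filter (λ v → mt v ≟ k) (allNodes t))

IsPartRoot : {t : Tree} → (Node t → ℕ) → Node t → Set
IsPartRoot {t} mt v = ∀ (u : Node t) → IsChild u v → ¬ (mt u ≡ mt v)

-- Properties of the Farzan–Munro partition with parameter B (as given in the
-- context) that hold for every micro tree.
record FMPartition (B : ℕ) (t : Tree) (mt : Node t → ℕ) : Set where
  field
    -- each micro tree is a connected set of nodes: it has exactly one topmost node
    connected : ∀ (x y : Node t) → mt x ≡ mt y → IsPartRoot mt x → IsPartRoot mt y → x ≡ y
    small : ∀ (k : ℕ) → partSize t mt k < 2 * B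
    -- the top-tier tree is binary: each micro tree has at most two child micro trees
    -- (a child micro tree of micro tree k is the micro tree of a node w ∉ k whose
    -- parent u lies in k)
    atMostTwoChildren :
      ∀ (k : ℕ) (u₁ w₁ u₂ w₂ u₃ w₃ : Node t) →
      IsChild u₁ w₁ → IsChild u₂ w₂ → IsChild u₃ w₃ →
      mt u₁ ≡ k → mt u₂ ≡ k → mt u₃ ≡ k →
      ¬ (mt w₁ ≡ k) → ¬ (mt w₂ ≡ k) → ¬ (mt w₃ ≡ k) →
      (mt w₁ ≡ mt w₂) ⊎ ((mt w₁ ≡ mt w₃) ⊎ (mt w₂ ≡ mt w₃))
    -- a micro tree with two (distinct) child micro trees consists of a single node
    twoChildrenSingleton :
      ∀ (k : ℕ) (u₁ w₁ u₂ w₂ : Node t) →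
      IsChild u₁ w₁ → IsChild u₂ w₂ →
      mt u₁ ≡ k → mt u₂ ≡ k →
      ¬ (mt w₁ ≡ k) → ¬ (mt w₂ ≡ k) → ¬ (mt w₁ ≡ mt w₂) →
      ∀ (x y : Node t) → mt x ≡ k → mt y ≡ k → x ≡ y

{-# OPTIONS --safe #-}
-- Label each parenthesis of BP_b(t) true when its node lies in the micro tree μ and pad the labels
-- with false at both ends: μ occupies one interval per maximal run of trues, and each run costs two
-- changes of label. The changes can be charged, two each, to the nodes whose label differs from
-- their parent's (the parent of the root counting as outside μ), namely the root of μ and the roots
-- of its child micro trees; they are also at most twice the number of trues, i.e. four times |μ|.
-- If μ has at most one child micro tree the first count gives at most four changes; otherwise μ is
-- a single node and the second count does.
module Submission where

open import Defs
open import Data.Bool using (Bool; true; false; not; _∧_; _∨_; _xor_; T)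
open import Data.Bool.Properties using (T-∧; T-∨; xor-comm)
open import Data.Empty using (⊥-elim)
open import Data.Fin using (Fin; toℕ; zero; suc)
open import Data.List using (List; []; _∷_; _++_; _∷ʳ_; map; length; lookup)
open import Data.List.Properties using (++-assoc; map-++; map-∘; length-map)
open import Data.Nat using (ℕ; zero; suc; _+_; _*_; _≤_; _<_; _<ᵇ_; z≤n; s≤s; s≤s⁻¹; z<s; s<s)
open import Data.Nat.Properties
  using (_≟_; _<?_; ≤-refl; ≤-trans; ≤-reflexive; <-≤-trans; ≤-<-trans; n≮n; ≮⇒≥; m≤n⇒m<n∨m≡n;
         +-identityʳ; +-assoc; +-mono-≤; +-monoʳ-≤; +-monoˡ-≤; *-monoʳ-≤; m≤m+n; m≤n+m;
         <ᵇ⇒<; <⇒<ᵇ; module ≤-Reasoning)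
open import Data.Nat.Tactic.RingSolver using (solve-∀)
open import Data.Product using (Σ; ∃; ∃₂; _×_; _,_; proj₂; map₂)
open import Data.Product.Function.NonDependent.Propositional using (_×-⇔_)
open import Data.Sum using (_⊎_; inj₁; inj₂; [_,_])
open import Data.Sum.Function.Propositional using (_⊎-⇔_)
open import Function using (_∘_; _⇔_; mk⇔; Equivalence)
open import Function.Construct.Composition using (_⇔-∘_)
open import Relation.Binary.PropositionalEquality
  using (_≡_; _≢_; _≗_; refl; sym; trans; cong; cong₂; subst; module ≡-Reasoning)
open import Relation.Nullary using (¬_; yes; no)
open import Relation.Nullary.Decidable using (⌊_⌋; toWitness; fromWitness; toWitnessFalse)

open Equivalence using (to)

bit : Bool → ℕ
bit false = 0
bit true  = 1

bit-xor-triangle : ∀ p q r → bit (p xor r) ≤ bit (p xor q) + bit (q xor r)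
bit-xor-triangle false false r     = ≤-refl
bit-xor-triangle true  true  r     = ≤-refl
bit-xor-triangle false true  false = z≤n
bit-xor-triangle false true  true  = ≤-refl
bit-xor-triangle true  false false = ≤-refl
bit-xor-triangle true  false true  = z≤n

bit-xor≤ : ∀ p q → bit (p xor q) ≤ bit p + bit q
bit-xor≤ false q     = ≤-refl
bit-xor≤ true  false = ≤-refl
bit-xor≤ true  true  = z≤n

bit-xor-split : ∀ p q → bit (p xor q) ≡ bit (not p ∧ q) + bit (p ∧ not q)
bit-xor-split false false = refl
bit-xor-split false true  = refl
bit-xor-split true  false = refl
bit-xor-split true  true  = refl

bit-pos : ∀ {p} → T p → 0 < bit p
bit-pos {true} _ = z<s

changes : Bool → List Bool → ℕ
changes p []       = 0
changes p (x ∷ xs) = bit (p xor x) + changes x xs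

changes-++-∷ : ∀ p xs q ys → changes p (xs ++ q ∷ ys) ≡ changes p (xs ∷ʳ q) + changes q ys
changes-++-∷ p []       q ys = cong (_+ changes q ys) (sym (+-identityʳ (bit (p xor q))))
changes-++-∷ p (x ∷ xs) q ys =
  trans (cong (bit (p xor x) +_) (changes-++-∷ x xs q ys)) (sym (+-assoc (bit (p xor x)) _ _))

changes-∷ʳ-≤ : ∀ p xs q r → changes p (xs ∷ʳ r) ≤ changes p (xs ∷ʳ q) + bit (q xor r)
changes-∷ʳ-≤ p [] q r rewrite +-identityʳ (bit (p xor r)) | +-identityʳ (bit (p xor q)) =
  bit-xor-triangle p q r
changes-∷ʳ-≤ p (x ∷ xs) q r =
  ≤-trans (+-monoʳ-≤ (bit (p xor x)) (changes-∷ʳ-≤ x xs q r))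
          (≤-reflexive (sym (+-assoc (bit (p xor x)) _ _)))

trues : List Bool → ℕ
trues []       = 0
trues (x ∷ xs) = bit x + trues xs

trues-++ : ∀ xs ys → trues (xs ++ ys) ≡ trues xs + trues ys
trues-++ []       ys = refl
trues-++ (x ∷ xs) ys = trans (cong (bit x +_) (trues-++ xs ys)) (sym (+-assoc (bit x) _ _))

changes-≤-trues : ∀ p ys → changes p (ys ∷ʳ false) ≤ bit p + 2 * trues ys
changes-≤-trues false []       = z≤n
changes-≤-trues true  []       = ≤-refl
changes-≤-trues p     (x ∷ ys) = begin
  bit (p xor x) + changes x (ys ∷ʳ false)   ≤⟨ +-mono-≤ (bit-xor≤ p x) (changes-≤-trues x ys) ⟩
  bit p + bit x + (bit x + 2 * trues ys)    ≡⟨ regroup (bit p) (bit x) (trues ys) ⟩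
  bit p + 2 * (bit x + trues ys)            ∎
  where
    open ≤-Reasoning
    regroup : ∀ a b c → a + b + (b + 2 * c) ≡ a + 2 * (b + c)
    regroup = solve-∀

some-true : ∀ ys → 0 < trues ys → ∃ λ i → T (lookup ys i)
some-true (true  ∷ ys) _ = zero , _
some-true (false ∷ ys) h = let i , yᵢ = some-true ys h in suc i , yᵢ

_∈[_,_⟩ : ℕ → ℕ → ℕ → Set
n ∈[ a , b ⟩ = a ≤ n × n < b

∉-empty : ∀ {a n} → ¬ n ∈[ a , a ⟩
∉-empty {a} (a≤n , n<a) = n≮n a (≤-<-trans a≤n n<a)

-- Written with _<ᵇ_ so that inRun (suc a) (suc b) (suc n) reduces to inRun a b n: prepending
-- an entry to a list shifts its runs definitionally.
inRun : ℕ → ℕ → ℕ → Bool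
inRun a b n = (a <ᵇ suc n) ∧ (n <ᵇ b)

inRuns : ℕ → ℕ → ℕ → ℕ → ℕ → Bool
inRuns a b c d n = inRun a b n ∨ inRun c d n

T-inRun : ∀ a b n → T (inRun a b n) ⇔ n ∈[ a , b ⟩
T-inRun a b n =
  (mk⇔ (s≤s⁻¹ ∘ <ᵇ⇒< a (suc n)) (<⇒<ᵇ ∘ s≤s) ×-⇔ mk⇔ (<ᵇ⇒< n b) <⇒<ᵇ) ⇔-∘ T-∧

T-inRuns : ∀ a b c d n → T (inRuns a b c d n) ⇔ (n ∈[ a , b ⟩ ⊎ n ∈[ c , d ⟩)
T-inRuns a b c d n = (T-inRun a b n ⊎-⇔ T-inRun c d n) ⇔-∘ T-∨

noRun : ∀ ys → changes false (ys ∷ʳ false) ≤ 0 → ∀ i → lookup ys i ≡ false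
noRun (false ∷ ys) h zero    = refl
noRun (false ∷ ys) h (suc i) = noRun ys h i

prefixRun : ∀ ys → changes true (ys ∷ʳ false) ≤ 1 →
  ∃ λ b → b ≤ length ys × lookup ys ≗ inRun 0 b ∘ toℕ
prefixRun []           h = 0 , z≤n , λ ()
prefixRun (false ∷ ys) h = 0 , z≤n , λ { zero → refl ; (suc i) → noRun ys (s≤s⁻¹ h) i }
prefixRun (true  ∷ ys) h =
  let b , b≤n , ys≗ = prefixRun ys h
  in suc b , s≤s b≤n , λ { zero → refl ; (suc i) → ys≗ i }

oneRun : ∀ ys → changes false (ys ∷ʳ false) ≤ 2 →
  ∃₂ λ a b → a ≤ b × b ≤ length ys × lookup ys ≗ inRun a b ∘ toℕ
oneRun []           h = 0 , 0 , z≤n , z≤n , λ ()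
oneRun (false ∷ ys) h =
  let a , b , a≤b , b≤n , ys≗ = oneRun ys h
  in suc a , suc b , s≤s a≤b , s≤s b≤n , λ { zero → refl ; (suc i) → ys≗ i }
oneRun (true  ∷ ys) h =
  let b , b≤n , ys≗ = prefixRun ys (s≤s⁻¹ h)
  in 0 , suc b , z≤n , s≤s b≤n , λ { zero → refl ; (suc i) → ys≗ i }

prefixRunThenRun : ∀ ys → changes true (ys ∷ʳ false) ≤ 3 →
  ∃₂ λ b c → ∃ λ d → b ≤ c × c ≤ d × d ≤ length ys × lookup ys ≗ inRuns 0 b c d ∘ toℕ
prefixRunThenRun []           h = 0 , 0 , 0 , z≤n , z≤n , z≤n , λ ()
prefixRunThenRun (false ∷ ys) h =
  let a , b , a≤b , b≤n , ys≗ = oneRun ys (s≤s⁻¹ h)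
  in 0 , suc a , suc b , z≤n , s≤s a≤b , s≤s b≤n , λ { zero → refl ; (suc i) → ys≗ i }
prefixRunThenRun (true  ∷ ys) h =
  let b , c , d , b≤c , c≤d , d≤n , ys≗ = prefixRunThenRun ys h
  in suc b , suc c , suc d , s≤s b≤c , s≤s c≤d , s≤s d≤n , λ { zero → refl ; (suc i) → ys≗ i }

twoRuns : ∀ ys → changes false (ys ∷ʳ false) ≤ 4 →
  ∃₂ λ a b → ∃₂ λ c d → a ≤ b × b ≤ c × c ≤ d × d ≤ length ys × lookup ys ≗ inRuns a b c d ∘ toℕ
twoRuns []           h = 0 , 0 , 0 , 0 , z≤n , z≤n , z≤n , z≤n , λ ()
twoRuns (false ∷ ys) h =
  let a , b , c , d , a≤b , b≤c , c≤d , d≤n , ys≗ = twoRuns ys h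
  in suc a , suc b , suc c , suc d , s≤s a≤b , s≤s b≤c , s≤s c≤d , s≤s d≤n ,
     λ { zero → refl ; (suc i) → ys≗ i }
twoRuns (true  ∷ ys) h =
  let b , c , d , b≤c , c≤d , d≤n , ys≗ = prefixRunThenRun ys (s≤s⁻¹ h)
  in 0 , suc b , suc c , suc d , z≤n , s≤s b≤c , s≤s c≤d , s≤s d≤n ,
     λ { zero → refl ; (suc i) → ys≗ i }

TwoIntervals : (n : ℕ) → (Fin n → Set) → Set
TwoIntervals n Q = Σ ℕ λ a → Σ ℕ λ b → Σ ℕ λ c → Σ ℕ λ d →
  (a < b) × (b ≤ c) × (c ≤ d) × (d ≤ n) ×
  (∀ i → Q i ⇔ (toℕ i ∈[ a , b ⟩ ⊎ toℕ i ∈[ c , d ⟩))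

twoIntervals : ∀ {n} {Q : Fin n → Set} {a b c d} → a ≤ b → b ≤ c → c ≤ d → d ≤ n →
  (∀ i → Q i ⇔ (toℕ i ∈[ a , b ⟩ ⊎ toℕ i ∈[ c , d ⟩)) → ∃ Q → TwoIntervals n Q
twoIntervals a≤b b≤c c≤d d≤n Q⇔ (j , qⱼ) with m≤n⇒m<n∨m≡n a≤b | to (Q⇔ j) qⱼ
... | inj₁ a<b  | _ = _ , _ , _ , _ , a<b , b≤c , c≤d , d≤n , Q⇔
... | inj₂ refl | inj₁ j∈∅ = ⊥-elim (∉-empty j∈∅)
... | inj₂ refl | inj₂ (c≤j , j<d) =
  _ , _ , _ , _ , ≤-<-trans c≤j j<d , ≤-refl , ≤-refl , d≤n ,
  λ i → mk⇔ [ ⊥-elim ∘ ∉-empty , inj₁ ] [ inj₂ , ⊥-elim ∘ ∉-empty ] ⇔-∘ Q⇔ i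

changes≤4⇒twoIntervals : ∀ ys → changes false (ys ∷ʳ false) ≤ 4 → 0 < trues ys →
  TwoIntervals (length ys) (T ∘ lookup ys)
changes≤4⇒twoIntervals ys h pos =
  let a , b , c , d , a≤b , b≤c , c≤d , d≤n , ys≗ = twoRuns ys h
  in twoIntervals a≤b b≤c c≤d d≤n
       (λ i → T-inRuns a b c d (toℕ i) ⇔-∘ mk⇔ (subst T (ys≗ i)) (subst T (sym (ys≗ i))))
       (some-true ys pos)

lookup-map-pointwise : ∀ {A B : Set} (f : A → B) (xs : List A) {R : B → ℕ → Set} →
  (∀ j → R (lookup (map f xs) j) (toℕ j)) → ∀ i → R (f (lookup xs i)) (toℕ i)
lookup-map-pointwise f (x ∷ xs) h zero    = h zero
lookup-map-pointwise f (x ∷ xs) {R} h (suc i) =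
  lookup-map-pointwise f xs {λ y n → R y (suc n)} (h ∘ suc) i

TwoIntervals-map : ∀ {A : Set} (f : A → Bool) (xs : List A) →
  TwoIntervals (length (map f xs)) (T ∘ lookup (map f xs)) →
  TwoIntervals (length xs) (T ∘ f ∘ lookup xs)
TwoIntervals-map f xs (a , b , c , d , a<b , b≤c , c≤d , d≤n , F) =
  a , b , c , d , a<b , b≤c , c≤d , subst (d ≤_) (length-map f xs) d≤n ,
  lookup-map-pointwise f xs {λ y n → T y ⇔ (n ∈[ a , b ⟩ ⊎ n ∈[ c , d ⟩)} F

TwoIntervals-cong : ∀ {n} {Q Q′ : Fin n → Set} → (∀ i → Q′ i ⇔ Q i) →
  TwoIntervals n Q → TwoIntervals n Q′
TwoIntervals-cong Q′⇔Q (a , b , c , d , a<b , b≤c , c≤d , d≤n , F) =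
  a , b , c , d , a<b , b≤c , c≤d , d≤n , λ i → F i ⇔-∘ Q′⇔Q i

count : (s : Tree) → (Node s → Bool) → ℕ
count leaf       q = 0
count (node l r) q = bit (q here) + count l (q ∘ inL) + count r (q ∘ inR)

count-pos : ∀ {s} (q : Node s → Bool) (x : Node s) → T (q x) → 0 < count s q
count-pos {node l r} q here    qx =
  <-≤-trans (bit-pos qx) (≤-trans (m≤m+n _ (count l (q ∘ inL))) (m≤m+n _ (count r (q ∘ inR))))
count-pos {node l r} q (inL x) qx =
  <-≤-trans (count-pos (q ∘ inL) x qx) (≤-trans (m≤n+m _ (bit (q here))) (m≤m+n _ (count r (q ∘ inR))))
count-pos {node l r} q (inR x) qx =
  <-≤-trans (count-pos (q ∘ inR) x qx) (m≤n+m _ (bit (q here) + count l (q ∘ inL)))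

count-xor : ∀ s (f g : Node s → Bool) →
  count s (λ x → f x xor g x) ≡ count s (λ x → not (f x) ∧ g x) + count s (λ x → f x ∧ not (g x))
count-xor leaf       f g = refl
count-xor (node l r) f g =
  trans (cong₂ _+_ (cong₂ _+_ (bit-xor-split (f here) (g here)) (count-xor l (f ∘ inL) (g ∘ inL)))
                   (count-xor r (f ∘ inR) (g ∘ inR)))
        (interchange (bit (not (f here) ∧ g here)) (bit (f here ∧ not (g here))) _ _ _ _)
  where
    interchange : ∀ a a′ b b′ c c′ → a + a′ + (b + b′) + (c + c′) ≡ a + b + c + (a′ + b′ + c′)
    interchange = solve-∀

m+n>0⇒m>0∨n>0 : ∀ m {n} → 0 < m + n → 0 < m ⊎ 0 < n
m+n>0⇒m>0∨n>0 zero    h = inj₂ h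
m+n>0⇒m>0∨n>0 (suc m) _ = inj₁ z<s

m+n>1⇒m>1∨n>1∨both>0 : ∀ m {n} → 1 < m + n → 1 < m ⊎ 1 < n ⊎ (0 < m × 0 < n)
m+n>1⇒m>1∨n>1∨both>0 zero                h           = inj₂ (inj₁ h)
m+n>1⇒m>1∨n>1∨both>0 (suc zero)    {zero} (s≤s ())
m+n>1⇒m>1∨n>1∨both>0 (suc zero)    {suc n} _         = inj₂ (inj₂ (z<s , z<s))
m+n>1⇒m>1∨n>1∨both>0 (suc (suc m))       _           = inj₁ (s<s z<s)

inL-injective : ∀ {l r} {x y : Node l} → inL {r = r} x ≡ inL y → x ≡ y
inL-injective refl = refl

inR-injective : ∀ {l r} {x y : Node r} → inR {l = l} x ≡ inR y → x ≡ y
inR-injective refl = refl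

pick : ∀ {s} (q : Node s → Bool) → 0 < count s q → ∃ λ x → T (q x)
pick {node l r} q h with q here in e
... | true  = here , subst T (sym e) _
... | false with m+n>0⇒m>0∨n>0 (count l (q ∘ inL)) h
...   | inj₁ hₗ = let x , qx = pick (q ∘ inL) hₗ in inL x , qx
...   | inj₂ hᵣ = let x , qx = pick (q ∘ inR) hᵣ in inR x , qx

twoDistinct : ∀ {s} (q : Node s → Bool) → 1 < count s q → ∃₂ λ x y → T (q x) × T (q y) × x ≢ y
twoDistinct {node l r} q h with q here in e
... | true with m+n>0⇒m>0∨n>0 (count l (q ∘ inL)) (s≤s⁻¹ h)
...   | inj₁ hₗ = let x , qx = pick (q ∘ inL) hₗ in here , inL x , subst T (sym e) _ , qx , λ ()
...   | inj₂ hᵣ = let x , qx = pick (q ∘ inR) hᵣ in here , inR x , subst T (sym e) _ , qx , λ ()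
twoDistinct {node l r} q h | false with m+n>1⇒m>1∨n>1∨both>0 (count l (q ∘ inL)) h
... | inj₁ hₗ = let x , y , qx , qy , x≢y = twoDistinct (q ∘ inL) hₗ
                in inL x , inL y , qx , qy , x≢y ∘ inL-injective
... | inj₂ (inj₁ hᵣ) = let x , y , qx , qy , x≢y = twoDistinct (q ∘ inR) hᵣ
                       in inR x , inR y , qx , qy , x≢y ∘ inR-injective
... | inj₂ (inj₂ (hₗ , hᵣ)) = let x , qx = pick (q ∘ inL) hₗ ; y , qy = pick (q ∘ inR) hᵣ
                              in inL x , inR y , qx , qy , λ ()

count≤1 : ∀ {s} (q : Node s → Bool) → (∀ x y → T (q x) → T (q y) → x ≡ y) → count s q ≤ 1
count≤1 {s} q unique with 1 <? count s q
... | no  ≯1 = ≮⇒≥ ≯1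
... | yes >1 = let x , y , qx , qy , x≢y = twoDistinct q >1 in ⊥-elim (x≢y (unique x y qx qy))

marks : (s : Tree) → (Node s → Bool) → List Bool
marks s P = map (P ∘ proj₂) (BPl s)

marks-node : ∀ l r (P : Node (node l r) → Bool) →
  marks (node l r) P ≡ P here ∷ (marks l (P ∘ inL) ++ P here ∷ marks r (P ∘ inR))
marks-node l r P = cong (P here ∷_) (begin
  map f (map (map₂ inL) (BPl l) ++ (close′ , here) ∷ map (map₂ inR) (BPl r))
    ≡⟨ map-++ f (map (map₂ inL) (BPl l)) _ ⟩
  map f (map (map₂ inL) (BPl l)) ++ P here ∷ map f (map (map₂ inR) (BPl r))
    ≡⟨ cong₂ (λ xs ys → xs ++ P here ∷ ys) (sym (map-∘ (BPl l))) (sym (map-∘ (BPl r))) ⟩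
  marks l (P ∘ inL) ++ P here ∷ marks r (P ∘ inR) ∎)
  where
    open ≡-Reasoning
    f : Paren × Node (node l r) → Bool
    f = P ∘ proj₂

trues-marks : ∀ s P → trues (marks s P) ≡ 2 * count s P
trues-marks leaf       P = refl
trues-marks (node l r) P = begin
  trues (marks (node l r) P)                     ≡⟨ cong trues (marks-node l r P) ⟩
  bit ρ + trues (marks l (P ∘ inL) ++ ρ ∷ marks r (P ∘ inR))
    ≡⟨ cong (bit ρ +_) (trues-++ (marks l (P ∘ inL)) _) ⟩
  bit ρ + (trues (marks l (P ∘ inL)) + (bit ρ + trues (marks r (P ∘ inR))))
    ≡⟨ cong₂ (λ m n → bit ρ + (m + (bit ρ + n))) (trues-marks l (P ∘ inL)) (trues-marks r (P ∘ inR)) ⟩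
  bit ρ + (2 * count l (P ∘ inL) + (bit ρ + 2 * count r (P ∘ inR)))
    ≡⟨ regroup (bit ρ) _ _ ⟩
  2 * count (node l r) P                         ∎
  where
    open ≡-Reasoning
    ρ : Bool
    ρ = P here
    regroup : ∀ a m n → a + (2 * m + (a + 2 * n)) ≡ 2 * (a + m + n)
    regroup = solve-∀

atParent : (s : Tree) → Bool → (Node s → Bool) → Node s → Bool
atParent (node l r) p P here    = p
atParent (node l r) p P (inL x) = atParent l (P here) (P ∘ inL) x
atParent (node l r) p P (inR x) = atParent r (P here) (P ∘ inR) x

crossing : (s : Tree) → Bool → (Node s → Bool) → Node s → Bool
crossing s p P x = atParent s p P x xor P x

-- The block of the right subtree is followed by the label p of the context rather than by ρ; the
-- extra change this may cost is the second one charged to the root.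
changes-marks≤ : ∀ s p P → changes p (marks s P ∷ʳ p) ≤ 2 * count s (crossing s p P)
changes-marks≤ leaf       false P = z≤n
changes-marks≤ leaf       true  P = z≤n
changes-marks≤ (node l r) p     P = begin
  changes p (marks (node l r) P ∷ʳ p)
    ≡⟨ cong (λ ys → changes p (ys ∷ʳ p)) (marks-node l r P) ⟩
  δ + changes ρ ((A ++ ρ ∷ C) ∷ʳ p)
    ≡⟨ cong (λ ys → δ + changes ρ ys) (++-assoc A (ρ ∷ C) (p ∷ [])) ⟩
  δ + changes ρ (A ++ ρ ∷ (C ∷ʳ p))
    ≡⟨ cong (δ +_) (changes-++-∷ ρ A ρ (C ∷ʳ p)) ⟩
  δ + (changes ρ (A ∷ʳ ρ) + changes ρ (C ∷ʳ p))
    ≤⟨ +-monoʳ-≤ δ (+-monoʳ-≤ (changes ρ (A ∷ʳ ρ)) (changes-∷ʳ-≤ ρ C ρ p)) ⟩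
  δ + (changes ρ (A ∷ʳ ρ) + (changes ρ (C ∷ʳ ρ) + bit (ρ xor p)))
    ≤⟨ +-monoʳ-≤ δ (+-mono-≤ (changes-marks≤ l ρ (P ∘ inL))
                              (+-monoˡ-≤ (bit (ρ xor p)) (changes-marks≤ r ρ (P ∘ inR)))) ⟩
  δ + (2 * cₗ + (2 * cᵣ + bit (ρ xor p)))
    ≡⟨ cong (λ y → δ + (2 * cₗ + (2 * cᵣ + bit y))) (xor-comm ρ p) ⟩
  δ + (2 * cₗ + (2 * cᵣ + δ))
    ≡⟨ regroup δ cₗ cᵣ ⟩
  2 * (δ + cₗ + cᵣ) ∎
  where
    open ≤-Reasoning
    ρ : Bool
    ρ = P here
    δ cₗ cᵣ : ℕ
    δ = bit (p xor ρ)
    cₗ = count l (crossing l ρ (P ∘ inL))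
    cᵣ = count r (crossing r ρ (P ∘ inR))
    A C : List Bool
    A = marks l (P ∘ inL)
    C = marks r (P ∘ inR)
    regroup : ∀ a m n → a + (2 * m + (2 * n + a)) ≡ 2 * (a + m + n)
    regroup = solve-∀

atParent-child : ∀ {s p} {P : Node s → Bool} {u x : Node s} → IsChild u x → atParent s p P x ≡ P u
atParent-child childL    = refl
atParent-child childR    = refl
atParent-child (deepL c) = atParent-child c
atParent-child (deepR c) = atParent-child c

data IsTop : {s : Tree} → Node s → Set where
  top : ∀ {l r} → IsTop {node l r} here

top-or-child : ∀ {s} (x : Node s) → IsTop x ⊎ ∃ λ u → IsChild u x
top-or-child here = inj₁ top
top-or-child (inL x) with top-or-child x
... | inj₁ top     = inj₂ (here , childL)
... | inj₂ (u , c) = inj₂ (inL u , deepL c)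
top-or-child (inR x) with top-or-child x
... | inj₁ top     = inj₂ (here , childR)
... | inj₂ (u , c) = inj₂ (inR u , deepR c)

atParent-parent : ∀ {s} {P : Node s → Bool} (x : Node s) → T (atParent s false P x) →
  ∃ λ u → IsChild u x × T (P u)
atParent-parent x h with top-or-child x
... | inj₁ top     = ⊥-elim h
... | inj₂ (u , c) = u , c , subst T (atParent-child c) h

module _ {B : ℕ} {t : Tree} {mt : Node t → ℕ} (fm : FMPartition B t mt) (v : Node t) where
  open FMPartition fm

  member : Node t → Bool
  member x = ⌊ mt x ≟ mt v ⌋

  entry exit : Node t → Bool
  entry x = not (atParent t false member x) ∧ member x
  exit  x = atParent t false member x ∧ not (member x)

  entry-partRoot : ∀ x → T (entry x) → mt x ≡ mt v × IsPartRoot mt x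
  entry-partRoot x h =
    let notAbove , inside = to T-∧ h ; mx = toWitness inside
    in mx , λ u c mu≡mx → toWitnessFalse (subst (T ∘ not) (atParent-child c) notAbove) (trans mu≡mx mx)

  exit-partRoot : ∀ w → T (exit w) →
    (∃ λ u → IsChild u w × mt u ≡ mt v) × ¬ (mt w ≡ mt v) × IsPartRoot mt w
  exit-partRoot w h =
    let above , outside = to T-∧ h ; u , c , inside = atParent-parent w above
    in (u , c , toWitness inside) , toWitnessFalse outside ,
       λ u′ c′ mu′≡mw → toWitnessFalse outside
         (trans (sym mu′≡mw) (toWitness (subst T (atParent-child c′) above)))

  entries≤1 : count t entry ≤ 1
  entries≤1 = count≤1 entry λ x y ex ey →
    let mx , rx = entry-partRoot x ex ; my , ry = entry-partRoot y ey
    in connected x y (trans mx (sym my)) rx ry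

  twoExits⇒singleton : 1 < count t exit → count t member ≤ 1
  twoExits⇒singleton h =
    let w₁ , w₂ , e₁ , e₂ , w₁≢w₂ = twoDistinct exit h
        (u₁ , c₁ , mu₁) , nw₁ , r₁ = exit-partRoot w₁ e₁
        (u₂ , c₂ , mu₂) , nw₂ , r₂ = exit-partRoot w₂ e₂
    in count≤1 member λ x y mx my →
         twoChildrenSingleton (mt v) u₁ w₁ u₂ w₂ c₁ c₂ mu₁ mu₂ nw₁ nw₂
           (λ mw₁≡mw₂ → w₁≢w₂ (connected w₁ w₂ mw₁≡mw₂ r₁ r₂)) x y (toWitness mx) (toWitness my)

  changes-part≤4 : changes false (marks t member ∷ʳ false) ≤ 4
  changes-part≤4 with 1 <? count t exit
  ... | yes >1 = begin
    changes false (marks t member ∷ʳ false) ≤⟨ changes-≤-trues false (marks t member) ⟩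
    2 * trues (marks t member)              ≡⟨ cong (2 *_) (trues-marks t member) ⟩
    2 * (2 * count t member)                ≤⟨ *-monoʳ-≤ 2 (*-monoʳ-≤ 2 (twoExits⇒singleton >1)) ⟩
    4                                       ∎
    where open ≤-Reasoning
  ... | no ≯1 = begin
    changes false (marks t member ∷ʳ false) ≤⟨ changes-marks≤ t false member ⟩
    2 * count t (crossing t false member)   ≡⟨ cong (2 *_) (count-xor t (atParent t false member) member) ⟩
    2 * (count t entry + count t exit)      ≤⟨ *-monoʳ-≤ 2 (+-mono-≤ entries≤1 (≮⇒≥ ≯1)) ⟩
    4                                       ∎
    where open ≤-Reasoning

  part-nonempty : 0 < trues (marks t member)
  part-nonempty = subst (0 <_) (sym (trues-marks t member))
    (<-≤-trans (count-pos member v (fromWitness refl)) (m≤m+n _ _))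

proposition11 :
  ∀ (B : ℕ) (t : Tree) (mt : Node t → ℕ) → FMPartition B t mt →
  ∀ (v : Node t) →
    Σ ℕ λ a → Σ ℕ λ b → Σ ℕ λ c → Σ ℕ λ d →
      (a < b) × (b ≤ c) × (c ≤ d) × (d ≤ length (BPl t)) ×
      (∀ (i : Fin (length (BPl t))) →
        (mt (proj₂ (lookup (BPl t) i)) ≡ mt v)
          ⇔ (((a ≤ toℕ i) × (toℕ i < b)) ⊎ ((c ≤ toℕ i) × (toℕ i < d))))
proposition11 B t mt fm v =
  TwoIntervals-cong (λ _ → mk⇔ fromWitness toWitness)
    (TwoIntervals-map (member fm v ∘ proj₂) (BPl t)
      (changes≤4⇒twoIntervals (marks t (member fm v)) (changes-part≤4 fm v) (part-nonempty fm v)))
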